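{- Let $n\ge2$ and consider the dihedral group $D_{2n}$. The only saturated subsets of $D_{2n}$ in which every power of $r$ that occurs is an odd power of $r$ are $A\cup B$, $A\cup C$ and $B\cup C$, where $A=\{r,r^3,\ldots,r^{2n-1}\}$, $B=\{f,fr^2,\ldots,fr^{2n-2}\}$, $C=\{fr,fr^3,\ldots,fr^{2n-1}\}$.
   Context: For $N\ge3$, $D_N$ is the group of order $2N$ generated by $r,f$ with relations $r^N=f^2=e$ and $fr=r^{ -1}f$; every element is uniquely $r^a$ or $fr^a$ with $a\in\mathbb{Z}/N\mathbb{Z}$. Here $N=2n$. For a group $S$, a subset $U\subseteq S$ is avoidable if there is a partition $\{A',B'\}$ of $S$ such that no element of $U$ equals $xy$ with $x\neq y$ both in $A'$ or both in $B'$ (in either order). A subset is saturated if it is maximal with respect to inclusion among the avoidable subsets. -}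

module Defs where

open import Data.Nat using (ℕ; zero; suc; _+_; _*_; _∸_; _%_)
open import Data.Nat.DivMod using (_mod_)
open import Data.Fin using (Fin; toℕ)
open import Data.Bool using (Bool)
open import Data.Product using (Σ; _×_; ∃; _,_)
open import Data.Sum using (_⊎_)
open import Relation.Binary.PropositionalEquality using (_≡_; _≢_)
open import Relation.Nullary using (¬_)
open import Level using (0ℓ)
open import Relation.Unary using (Pred; _⊆_)

-- Arithmetic in ℤ/Nℤ, with residues represented by Fin N.
-- (For N = 0 there are no residues, so nothing needs defining.)
_⊕_ : ∀ {N} → Fin N → Fin N → Fin N
_⊕_ {suc k} a b = (toℕ a + toℕ b) mod suc k

_⊖_ : ∀ {N} → Fin N → Fin N → Fin N
_⊖_ {suc k} b a = (toℕ b + (suc k ∸ toℕ a)) mod suc k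

-- Elements of the dihedral group D_N: rot a = r^a, ref a = f r^a.
data Dih (N : ℕ) : Set where
  rot : Fin N → Dih N
  ref : Fin N → Dih N

-- Multiplication, using f r = r⁻¹ f:
--   r^a r^b = r^(a+b),   r^a (f r^b) = f r^(b-a),
--   (f r^a) r^b = f r^(a+b),   (f r^a)(f r^b) = r^(b-a).
_·_ : ∀ {N} → Dih N → Dih N → Dih N
rot a · rot b = rot (a ⊕ b)
rot a · ref b = ref (b ⊖ a)
ref a · rot b = ref (a ⊕ b)
ref a · ref b = rot (b ⊖ a)

Subset : ℕ → Set₁
Subset N = Pred (Dih N) 0ℓ

-- A partition {A', B'} of D_N into two (nonempty) blocks is given by a
-- colouring c : D_N → Bool with both colour classes nonempty;
-- A' = c⁻¹(true), B' = c⁻¹(false).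
IsPartition : ∀ {N} → (Dih N → Bool) → Set
IsPartition {N} c = (∃ λ x → c x ≡ Bool.true) × (∃ λ y → c y ≡ Bool.false)
  where import Data.Bool as Bool

-- U is avoidable: some partition {A',B'} such that no element of U is x·y
-- with x ≢ y in the same block (both orders are covered since x,y range freely).
Avoidable : ∀ {N} → Subset N → Set
Avoidable {N} U =
  Σ (Dih N → Bool) λ c → IsPartition c ×
    (∀ x y → x ≢ y → c x ≡ c y → ¬ U (x · y))

Saturated : ∀ {N} → Subset N → Set₁
Saturated {N} U = Avoidable U × (∀ (V : Subset N) → U ⊆ V → Avoidable V → V ⊆ U)

_≐_ : ∀ {N} → Subset N → Subset N → Set
U ≐ V = (U ⊆ V) × (V ⊆ U)

Odd : ∀ {N} → Fin N → Set
Odd a = toℕ a % 2 ≡ 1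

Even : ∀ {N} → Fin N → Set
Even a = toℕ a % 2 ≡ 0

setA : ∀ {N} → Subset N
setA (rot a) = Odd a
setA (ref a) = Data.Empty.⊥ where import Data.Empty

setB : ∀ {N} → Subset N
setB (rot a) = Data.Empty.⊥ where import Data.Empty
setB (ref a) = Even a

setC : ∀ {N} → Subset N
setC (rot a) = Data.Empty.⊥ where import Data.Empty
setC (ref a) = Odd a

_∪_ : ∀ {N} → Subset N → Subset N → Subset N
(U ∪ V) x = U x ⊎ V x

OnlyOddRotations : ∀ {N} → Subset N → Set
OnlyOddRotations U = ∀ a → U (rot a) → Odd a

{-# OPTIONS --safe #-}
-- For even N the three nontrivial characters χ : D_N → ℤ/2 (the orientation, the parity of
-- the exponent, and their sum) have B ∪ C, A ∪ C and A ∪ B as the complements χ⁻¹(1) of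
-- their kernels.  Colouring by χ avoids χ⁻¹(1).  Conversely, a colouring c avoiding χ⁻¹(1)
-- gives x and y different colours whenever χ x ≢ χ y, since otherwise x · y ∈ χ⁻¹(1) would be
-- a monochromatic product; so c is the colouring by χ up to swapping colours, and as every
-- element of D_N (N ≥ 3) is a product of two distinct elements, each element of ker χ is a
-- monochromatic product.  Hence χ⁻¹(1) is saturated.
-- A saturated U is the set of all elements avoided by some colouring c.  If U contains a
-- rotation r^a ≠ e and reflections fr^d, fr^d' of different parity, let β m be the colour of
-- fr^m: avoiding r^a makes β antiperiodic with antiperiod a, while avoiding fr^d and fr^d'
-- makes it periodic with the odd period d − d', so β (a (d − d')) is both β 0 and its
-- negation.  So the reflections in U share a parity, U lies in one of the three sets, and by
-- maximality equals it.

module Submission where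

open import Defs
open import Data.Nat using (ℕ; _≤_; _*_)
open import Data.Sum using (_⊎_)
open import Function.Bundles using (_⇔_)

open import Data.Bool using (Bool; true; false)
import Data.Bool.Properties as Bool
open import Data.Empty using (⊥-elim)
open import Data.Fin using (Fin; zero; suc; toℕ; fromℕ)
import Data.Fin.Properties as Fin
open import Data.Nat using (zero; suc; s≤s; _+_; _∸_; _%_; _/_; NonZero; parity)
open import Data.Nat.DivMod
  using (_mod_; m≡m%n+[m/n]*n; m%n%n≡m%n; %-distribˡ-+; [m+n]%n≡m%n; [m+kn]%n≡m%n; n%n≡0; m%n≤n; m<n⇒m%n≡m)
open import Data.Nat.Properties
  using (+-assoc; +-comm; +-identityʳ; *-comm; m+[n∸m]≡n; m∸n+n≡m; <⇒≤; suc-injective; m+1+n≢0)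
open import Data.Nat.Tactic.RingSolver using (solve-∀)
open import Data.Parity.Base as ℙ using (Parity; 0ℙ; 1ℙ; _⁻¹)
import Data.Parity.Properties as ℙ
open import Algebra.Properties.CommutativeSemigroup ℙ.+-commutativeSemigroup using (interchange)
open import Data.Product using (∃; ∃₂; _×_; _,_; proj₁)
open import Data.Sum using (inj₁; inj₂; [_,_])
open import Function.Base using (_∘_)
open import Function.Bundles using (mk⇔; module Equivalence)
open import Relation.Binary.Definitions using (DecidableEquality)
open import Relation.Binary.PropositionalEquality
  using (_≡_; _≢_; refl; sym; trans; cong; cong₂; module ≡-Reasoning)
open import Relation.Nullary using (¬_; Dec; yes; no)
open import Relation.Nullary.Decidable using (map′; ¬?; _×-dec_; _⊎-dec_)
open import Relation.Unary using (Pred; Decidable; _⊆_)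

open Equivalence using (to; from)
open ≡-Reasoning

-- Parity

m%2≡1⇔parity≡1ℙ : ∀ m → m % 2 ≡ 1 ⇔ parity m ≡ 1ℙ
m%2≡1⇔parity≡1ℙ 0             = mk⇔ (λ ()) (λ ())
m%2≡1⇔parity≡1ℙ 1             = mk⇔ (λ _ → refl) (λ _ → refl)
m%2≡1⇔parity≡1ℙ (suc (suc m)) = m%2≡1⇔parity≡1ℙ m

m%2≡0⇔parity≡0ℙ : ∀ m → m % 2 ≡ 0 ⇔ parity m ≡ 0ℙ
m%2≡0⇔parity≡0ℙ 0             = mk⇔ (λ _ → refl) (λ _ → refl)
m%2≡0⇔parity≡0ℙ 1             = mk⇔ (λ ()) (λ ())
m%2≡0⇔parity≡0ℙ (suc (suc m)) = m%2≡0⇔parity≡0ℙ m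

Even-resp-parity : ∀ {N} {a b : Fin N} → parity (toℕ a) ≡ parity (toℕ b) → Even a → Even b
Even-resp-parity {a = a} {b} same even =
  from (m%2≡0⇔parity≡0ℙ (toℕ b)) (trans (sym same) (to (m%2≡0⇔parity≡0ℙ (toℕ a)) even))

Odd-resp-parity : ∀ {N} {a b : Fin N} → parity (toℕ a) ≡ parity (toℕ b) → Odd a → Odd b
Odd-resp-parity {a = a} {b} same odd =
  from (m%2≡1⇔parity≡1ℙ (toℕ b)) (trans (sym same) (to (m%2≡1⇔parity≡1ℙ (toℕ a)) odd))

even-or-odd : ∀ {N} (a : Fin N) → Even a ⊎ Odd a
even-or-odd a with parity (toℕ a) in eq
... | 0ℙ = inj₁ (from (m%2≡0⇔parity≡0ℙ (toℕ a)) eq)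
... | 1ℙ = inj₂ (from (m%2≡1⇔parity≡1ℙ (toℕ a)) eq)

≢⇒+≡1ℙ : ∀ {p q} → p ≢ q → p ℙ.+ q ≡ 1ℙ
≢⇒+≡1ℙ {0ℙ} {0ℙ} p≢q = ⊥-elim (p≢q refl)
≢⇒+≡1ℙ {0ℙ} {1ℙ} _   = refl
≢⇒+≡1ℙ {1ℙ} {0ℙ} _   = refl
≢⇒+≡1ℙ {1ℙ} {1ℙ} p≢q = ⊥-elim (p≢q refl)

+≡0ℙ⇒≡ : ∀ {p q} → p ℙ.+ q ≡ 0ℙ → p ≡ q
+≡0ℙ⇒≡ {p} {q} p+q≡0ℙ = ℙ.+-cancelʳ-≡ q p q (trans p+q≡0ℙ (sym (ℙ.p+p≡0ℙ q)))

parity-∸ : ∀ {m n} → n ≤ m → parity (m ∸ n) ≡ parity m ℙ.+ parity n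
parity-∸ {m} {n} n≤m = begin
  parity (m ∸ n)                                ≡⟨ ℙ.+-identityʳ _ ⟨
  parity (m ∸ n) ℙ.+ 0ℙ                         ≡⟨ cong (parity (m ∸ n) ℙ.+_) (ℙ.p+p≡0ℙ (parity n)) ⟨
  parity (m ∸ n) ℙ.+ (parity n ℙ.+ parity n)    ≡⟨ ℙ.+-assoc (parity (m ∸ n)) (parity n) (parity n) ⟨
  parity (m ∸ n) ℙ.+ parity n ℙ.+ parity n      ≡⟨ cong (ℙ._+ parity n) (ℙ.+-homo-+ (m ∸ n) n) ⟨
  parity (m ∸ n + n) ℙ.+ parity n               ≡⟨ cong (λ t → parity t ℙ.+ parity n) (m∸n+n≡m n≤m) ⟩
  parity m ℙ.+ parity n                         ∎

parity-% : ∀ m {n} .{{_ : NonZero n}} → parity n ≡ 0ℙ → parity (m % n) ≡ parity m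
parity-% m {n} parity[n]≡0ℙ = begin
  parity (m % n)                              ≡⟨ ℙ.+-identityʳ _ ⟨
  parity (m % n) ℙ.+ 0ℙ                       ≡⟨ cong (parity (m % n) ℙ.+_) parity[m/n*n]≡0ℙ ⟨
  parity (m % n) ℙ.+ parity (m / n * n)       ≡⟨ ℙ.+-homo-+ (m % n) (m / n * n) ⟨
  parity (m % n + m / n * n)                  ≡⟨ cong parity (m≡m%n+[m/n]*n m n) ⟨
  parity m                                    ∎
  where
  parity[m/n*n]≡0ℙ : parity (m / n * n) ≡ 0ℙ
  parity[m/n*n]≡0ℙ = begin
    parity (m / n * n)            ≡⟨ ℙ.*-homo-* (m / n) n ⟩
    parity (m / n) ℙ.* parity n   ≡⟨ cong (parity (m / n) ℙ.*_) parity[n]≡0ℙ ⟩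
    parity (m / n) ℙ.* 0ℙ         ≡⟨ ℙ.*-zeroʳ _ ⟩
    0ℙ                            ∎

-- Periodic and antiperiodic Boolean sequences

Periodic Antiperiodic : (ℕ → Bool) → ℕ → Set
Periodic f s = ∀ u → f (u + s) ≡ f u
Antiperiodic f s = ∀ u → f (u + s) ≢ f u

≢∧≢⇒≡ : ∀ {x y z : Bool} → x ≢ z → y ≢ z → x ≡ y
≢∧≢⇒≡ x≢z y≢z = trans (Bool.¬-not x≢z) (sym (Bool.¬-not y≢z))

periodic-* : ∀ {f s} → Periodic f s → ∀ j → Periodic f (j * s)
periodic-* {f} per zero    u = cong f (+-identityʳ u)
periodic-* {f} {s} per (suc j) u = begin
  f (u + (s + j * s))  ≡⟨ cong f (+-assoc u s (j * s)) ⟨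
  f (u + s + j * s)    ≡⟨ periodic-* per j (u + s) ⟩
  f (u + s)            ≡⟨ per u ⟩
  f u                  ∎

antiperiodic-* : ∀ {f s} → Antiperiodic f s → ∀ j → parity j ≡ 1ℙ → Antiperiodic f (j * s)
antiperiodic-* {f} {s} anti 1 _ u = anti u ∘ trans (cong (λ t → f (u + t)) (sym (+-identityʳ s)))
antiperiodic-* {f} {s} anti (suc (suc j)) parity[j]≡1ℙ u f[u+⋯]≡f[u] =
  antiperiodic-* anti j parity[j]≡1ℙ v (begin
    f (v + j * s)              ≡⟨ cong f (trans (+-assoc (u + s) s (j * s)) (+-assoc u s (s + j * s))) ⟩
    f (u + (s + (s + j * s)))  ≡⟨ f[u+⋯]≡f[u] ⟩
    f u                        ≡⟨ ≢∧≢⇒≡ (anti (u + s)) (anti u ∘ sym) ⟨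
    f v                        ∎)
  where v = u + s + s

antiperiodic∧periodic⇒parity≡0ℙ : ∀ {f a e} → Antiperiodic f a → Periodic f e → parity e ≡ 0ℙ
antiperiodic∧periodic⇒parity≡0ℙ {f} {a} {e} anti per with parity e in parity[e]≡p
... | 0ℙ = refl
... | 1ℙ = ⊥-elim (antiperiodic-* anti e parity[e]≡p 0 (trans (cong f (*-comm e a)) (periodic-* per a 0)))

-- Arithmetic modulo N = suc k

[m%n+o]%n≡[m+o]%n : ∀ m o n .{{_ : NonZero n}} → (m % n + o) % n ≡ (m + o) % n
[m%n+o]%n≡[m+o]%n m o n = begin
  (m % n + o) % n          ≡⟨ %-distribˡ-+ (m % n) o n ⟩
  (m % n % n + o % n) % n  ≡⟨ cong (λ t → (t + o % n) % n) (m%n%n≡m%n m n) ⟩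
  (m % n + o % n) % n      ≡⟨ %-distribˡ-+ m o n ⟨
  (m + o) % n              ∎

module _ {k : ℕ} where

  toℕ-mod : ∀ m → toℕ (m mod suc k) ≡ m % suc k
  toℕ-mod m = Fin.toℕ-fromℕ< _

  mod-cong : ∀ m n → m % suc k ≡ n % suc k → m mod suc k ≡ n mod suc k
  mod-cong m n eq = Fin.toℕ-injective (trans (toℕ-mod m) (trans eq (sym (toℕ-mod n))))

  toℕ-mod-inverse : ∀ (x : Fin (suc k)) → toℕ x mod suc k ≡ x
  toℕ-mod-inverse x = Fin.toℕ-injective (trans (toℕ-mod (toℕ x)) (m<n⇒m%n≡m (Fin.toℕ<n x)))

  [m+N]mod≡m-mod : ∀ m → (m + suc k) mod suc k ≡ m mod suc k
  [m+N]mod≡m-mod m = mod-cong (m + suc k) m ([m+n]%n≡m%n m (suc k))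

  [m+n]mod⊖m-mod≡n-mod : ∀ m n → ((m + n) mod suc k) ⊖ (m mod suc k) ≡ n mod suc k
  [m+n]mod⊖m-mod≡n-mod m n = mod-cong (toℕ ((m + n) mod N) + (N ∸ toℕ (m mod N))) n (begin
    (toℕ ((m + n) mod N) + (N ∸ toℕ (m mod N))) % N  ≡⟨ cong₂ (λ s t → (s + (N ∸ t)) % N) (toℕ-mod (m + n)) (toℕ-mod m) ⟩
    ((m + n) % N + (N ∸ m % N)) % N                  ≡⟨ [m%n+o]%n≡[m+o]%n (m + n) (N ∸ m % N) N ⟩
    (m + n + (N ∸ m % N)) % N                        ≡⟨ cong (_% N) regroup ⟩
    (n + N + m / N * N) % N                          ≡⟨ [m+kn]%n≡m%n (n + N) (m / N) N ⟩
    (n + N) % N                                      ≡⟨ [m+n]%n≡m%n n N ⟩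
    n % N                                            ∎)
    where
    N = suc k
    regroup : m + n + (N ∸ m % N) ≡ n + N + m / N * N
    regroup = begin
      m + n + (N ∸ m % N)                    ≡⟨ cong (λ t → t + n + (N ∸ m % N)) (m≡m%n+[m/n]*n m N) ⟩
      m % N + m / N * N + n + (N ∸ m % N)    ≡⟨ shuffle (m % N) (m / N * N) n (N ∸ m % N) ⟩
      n + (m % N + (N ∸ m % N)) + m / N * N  ≡⟨ cong (λ t → n + t + m / N * N) (m+[n∸m]≡n (m%n≤n m N)) ⟩
      n + N + m / N * N                      ∎
      where
      shuffle : ∀ a b c d → a + b + c + d ≡ c + (a + d) + b
      shuffle = solve-∀

  ⊖-self : ∀ (x : Fin (suc k)) → x ⊖ x ≡ zero
  ⊖-self x = mod-cong (toℕ x + (suc k ∸ toℕ x)) 0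
    (trans (cong (_% suc k) (m+[n∸m]≡n (<⇒≤ (Fin.toℕ<n x)))) (n%n≡0 (suc k)))

  ⊖-identityʳ : ∀ (x : Fin (suc k)) → x ⊖ zero ≡ x
  ⊖-identityʳ x =
    trans (mod-cong (toℕ x + suc k) (toℕ x) ([m+n]%n≡m%n (toℕ x) (suc k))) (toℕ-mod-inverse x)

  module _ (N-even : parity (suc k) ≡ 0ℙ) where

    parity-⊕ : ∀ (a b : Fin (suc k)) → parity (toℕ (a ⊕ b)) ≡ parity (toℕ a) ℙ.+ parity (toℕ b)
    parity-⊕ a b = begin
      parity (toℕ (a ⊕ b))                 ≡⟨ cong parity (toℕ-mod (toℕ a + toℕ b)) ⟩
      parity ((toℕ a + toℕ b) % suc k)     ≡⟨ parity-% (toℕ a + toℕ b) N-even ⟩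
      parity (toℕ a + toℕ b)               ≡⟨ ℙ.+-homo-+ (toℕ a) (toℕ b) ⟩
      parity (toℕ a) ℙ.+ parity (toℕ b)    ∎

    parity-⊖ : ∀ (b a : Fin (suc k)) → parity (toℕ (b ⊖ a)) ≡ parity (toℕ a) ℙ.+ parity (toℕ b)
    parity-⊖ b a = begin
      parity (toℕ (b ⊖ a))                    ≡⟨ cong parity (toℕ-mod (toℕ b + (N ∸ toℕ a))) ⟩
      parity ((toℕ b + (N ∸ toℕ a)) % N)      ≡⟨ parity-% (toℕ b + (N ∸ toℕ a)) N-even ⟩
      parity (toℕ b + (N ∸ toℕ a))            ≡⟨ ℙ.+-homo-+ (toℕ b) (N ∸ toℕ a) ⟩
      pb ℙ.+ parity (N ∸ toℕ a)               ≡⟨ cong (pb ℙ.+_) (parity-∸ (<⇒≤ (Fin.toℕ<n a))) ⟩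
      pb ℙ.+ (parity N ℙ.+ pa)                ≡⟨ cong (λ p → pb ℙ.+ (p ℙ.+ pa)) N-even ⟩
      pb ℙ.+ pa                               ≡⟨ ℙ.+-comm pb pa ⟩
      pa ℙ.+ pb                               ∎
      where
      N = suc k
      pa = parity (toℕ a)
      pb = parity (toℕ b)

-- The dihedral group

module _ {N : ℕ} where

  rot-injective : ∀ {a b : Fin N} → rot a ≡ rot b → a ≡ b
  rot-injective refl = refl

  ref-injective : ∀ {a b : Fin N} → ref a ≡ ref b → a ≡ b
  ref-injective refl = refl

  infix 4 _≟_
  _≟_ : DecidableEquality (Dih N)
  rot a ≟ rot b = map′ (cong rot) rot-injective (a Fin.≟ b)
  rot _ ≟ ref _ = no λ ()
  ref _ ≟ rot _ = no λ ()
  ref a ≟ ref b = map′ (cong ref) ref-injective (a Fin.≟ b)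

  any? : ∀ {p} {P : Pred (Dih N) p} → Decidable P → Dec (∃ P)
  any? {P = P} P? = map′ [ (λ (a , pa) → rot a , pa) , (λ (a , pa) → ref a , pa) ] split
                         (Fin.any? (P? ∘ rot) ⊎-dec Fin.any? (P? ∘ ref))
    where
    split : ∃ P → ∃ (P ∘ rot) ⊎ ∃ (P ∘ ref)
    split (rot a , pa) = inj₁ (a , pa)
    split (ref a , pa) = inj₂ (a , pa)

  DistinctFactors : Dih N → Set
  DistinctFactors z = ∃₂ λ x y → x ≢ y × x · y ≡ z

distinctFactors : ∀ {k} → k ≢ 0 → (z : Dih (suc (suc k))) → DistinctFactors z
distinctFactors {k} k≢0 (rot zero) = rot (suc zero) , rot (fromℕ (suc k)) , distinct , cong rot wrap
  where
  distinct : rot (suc zero) ≢ rot (fromℕ (suc k))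
  distinct eq = k≢0 (trans (sym (Fin.toℕ-fromℕ k)) (sym (suc-injective (cong toℕ (rot-injective eq)))))
  wrap : suc zero ⊕ fromℕ (suc k) ≡ zero
  wrap = mod-cong (suc (toℕ (fromℕ (suc k)))) 0
           (trans (cong (λ t → suc t % suc (suc k)) (Fin.toℕ-fromℕ (suc k))) (n%n≡0 (suc (suc k))))
distinctFactors k≢0 (rot (suc a)) = ref zero , ref (suc a) , (λ ()) , cong rot (⊖-identityʳ (suc a))
distinctFactors k≢0 (ref d)       = rot zero , ref d , (λ ()) , cong ref (⊖-identityʳ d)

-- Colourings and the sets they avoid

Colouring : ℕ → Set
Colouring N = Dih N → Bool

module _ {N : ℕ} where

  MonoProduct : Colouring N → Dih N → Set
  MonoProduct c z = ∃₂ λ x y → x ≢ y × c x ≡ c y × x · y ≡ z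

  Avoided : Colouring N → Subset N
  Avoided c z = ¬ MonoProduct c z

  Avoided? : ∀ c → Decidable (Avoided c)
  Avoided? c z = ¬? (any? λ x → any? λ y → ¬? (x ≟ y) ×-dec c x Bool.≟ c y ×-dec x · y ≟ z)

  avoids⇒⊆Avoided : ∀ {c} {U : Subset N} → (∀ x y → x ≢ y → c x ≡ c y → ¬ U (x · y)) → U ⊆ Avoided c
  avoids⇒⊆Avoided avoids Uz (x , y , x≢y , same , refl) = avoids x y x≢y same Uz

  Avoided-avoidable : ∀ {c} → IsPartition c → Avoidable (Avoided c)
  Avoided-avoidable {c} partition = c , partition , λ x y x≢y same avoided → avoided (x , y , x≢y , same , refl)

  saturated⇒≐Avoided : ∀ {U : Subset N} → Saturated U → ∃ λ c → U ≐ Avoided c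
  saturated⇒≐Avoided ((c , partition , avoids) , maximal) =
    c , U⊆Avoided , maximal (Avoided c) U⊆Avoided (Avoided-avoidable partition)
    where U⊆Avoided = avoids⇒⊆Avoided avoids

  saturated-⊆⇒≐ : ∀ {U V : Subset N} → Saturated U → U ⊆ V → Avoidable V → U ≐ V
  saturated-⊆⇒≐ (_ , maximal) U⊆V V-avoidable = U⊆V , maximal _ U⊆V V-avoidable

  Saturated-respects-≐ : ∀ {U V : Subset N} → U ≐ V → Saturated V → Saturated U
  Saturated-respects-≐ (U⊆V , V⊆U) ((c , partition , avoids) , maximal) =
    (c , partition , λ x y x≢y same Uxy → avoids x y x≢y same (U⊆V Uxy)) ,
    λ W U⊆W W-avoidable Wz → V⊆U (maximal W (U⊆W ∘ V⊆U) W-avoidable Wz)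

-- Characters D_N → ℤ/2

module _ {N : ℕ} where

  IsCharacter : (Dih N → Parity) → Set
  IsCharacter χ = ∀ x y → χ (x · y) ≡ χ x ℙ.+ χ y

  OffKernel : (Dih N → Parity) → Subset N
  OffKernel χ z = χ z ≡ 1ℙ

  IsCharacter-+ : ∀ {χ ψ} → IsCharacter χ → IsCharacter ψ → IsCharacter (λ x → χ x ℙ.+ ψ x)
  IsCharacter-+ {χ} {ψ} χ-hom ψ-hom x y =
    trans (cong₂ ℙ._+_ (χ-hom x y) (ψ-hom x y)) (interchange (χ x) (χ y) (ψ x) (ψ y))

  module _ {χ : Dih N → Parity} (χ-hom : IsCharacter χ) {w : Dih N} (χw≡1ℙ : χ w ≡ 1ℙ) where

    private
      χ[w·w]≡0ℙ : χ (w · w) ≡ 0ℙ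
      χ[w·w]≡0ℙ = trans (χ-hom w w) (ℙ.p+p≡0ℙ (χ w))

      isOne : Parity → Bool
      isOne 0ℙ = false
      isOne 1ℙ = true

      isOne-injective : ∀ {p q} → isOne p ≡ isOne q → p ≡ q
      isOne-injective {0ℙ} {0ℙ} _ = refl
      isOne-injective {1ℙ} {1ℙ} _ = refl

      otherValue : ∀ x → ∃ λ v → χ x ≢ χ v
      otherValue x with χ x
      ... | 0ℙ = w , λ 0ℙ≡χw → ℙ.p≢p⁻¹ 0ℙ (trans 0ℙ≡χw χw≡1ℙ)
      ... | 1ℙ = w · w , λ 1ℙ≡χ[w·w] → ℙ.p≢p⁻¹ 1ℙ (trans 1ℙ≡χ[w·w] χ[w·w]≡0ℙ)

    OffKernel-avoidable : Avoidable (OffKernel χ)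
    OffKernel-avoidable = isOne ∘ χ , ((w , cong isOne χw≡1ℙ) , (w · w , cong isOne χ[w·w]≡0ℙ)) , avoids
      where
      avoids : ∀ x y → x ≢ y → isOne (χ x) ≡ isOne (χ y) → ¬ OffKernel χ (x · y)
      avoids x y _ same χ[x·y]≡1ℙ = ℙ.p≢p⁻¹ 0ℙ (begin
        0ℙ               ≡⟨ ℙ.p+p≡0ℙ (χ x) ⟨
        χ x ℙ.+ χ x      ≡⟨ cong (χ x ℙ.+_) (isOne-injective same) ⟩
        χ x ℙ.+ χ y      ≡⟨ χ-hom x y ⟨
        χ (x · y)        ≡⟨ χ[x·y]≡1ℙ ⟩
        1ℙ               ∎)

    module _ {c : Colouring N} (OffKernel⊆Avoided : OffKernel χ ⊆ Avoided c) where

      colour-separates : ∀ {x y} → χ x ≢ χ y → c x ≢ c y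
      colour-separates {x} {y} χx≢χy same =
        OffKernel⊆Avoided (trans (χ-hom x y) (≢⇒+≡1ℙ χx≢χy)) (x , y , χx≢χy ∘ cong χ , same , refl)

      colour-respects : ∀ {x y} → χ x ≡ χ y → c x ≡ c y
      colour-respects {x} {y} χx≡χy =
        let v , χx≢χv = otherValue x in
        ≢∧≢⇒≡ (colour-separates χx≢χv) (colour-separates (χx≢χv ∘ trans χx≡χy))

      Avoided⊆OffKernel : (∀ z → DistinctFactors z) → Avoided c ⊆ OffKernel χ
      Avoided⊆OffKernel factors {z} avoided with χ z in χz≡p | factors z
      ... | 1ℙ | _ = refl
      ... | 0ℙ | x , y , x≢y , refl =
        ⊥-elim (avoided (x , y , x≢y , colour-respects (+≡0ℙ⇒≡ (trans (sym (χ-hom x y)) χz≡p)) , refl))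

    OffKernel-saturated : (∀ z → DistinctFactors z) → Saturated (OffKernel χ)
    OffKernel-saturated factors = OffKernel-avoidable , λ V OffKernel⊆V (c , _ , avoids) Vz →
      let V⊆Avoided = avoids⇒⊆Avoided avoids in
      Avoided⊆OffKernel (V⊆Avoided ∘ OffKernel⊆V) factors (V⊆Avoided Vz)

orientation : ∀ {N} → Dih N → Parity
orientation (rot _) = 0ℙ
orientation (ref _) = 1ℙ

exponentParity : ∀ {N} → Dih N → Parity
exponentParity (rot a) = parity (toℕ a)
exponentParity (ref a) = parity (toℕ a)

orientation-isCharacter : ∀ {N} → IsCharacter {N} orientation
orientation-isCharacter (rot _) (rot _) = refl
orientation-isCharacter (rot _) (ref _) = refl
orientation-isCharacter (ref _) (rot _) = refl
orientation-isCharacter (ref _) (ref _) = refl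

exponentParity-isCharacter : ∀ {k} → parity (suc k) ≡ 0ℙ → IsCharacter {suc k} exponentParity
exponentParity-isCharacter N-even (rot a) (rot b) = parity-⊕ N-even a b
exponentParity-isCharacter N-even (rot a) (ref b) = parity-⊖ N-even b a
exponentParity-isCharacter N-even (ref a) (rot b) = parity-⊕ N-even a b
exponentParity-isCharacter N-even (ref a) (ref b) = parity-⊖ N-even b a

module _ {N : ℕ} where

  setA∪setB≐OffKernel : (setA ∪ setB) ≐ OffKernel {N} (λ x → orientation x ℙ.+ exponentParity x)
  setA∪setB≐OffKernel = (λ { {rot a} (inj₁ odd)  → to (m%2≡1⇔parity≡1ℙ (toℕ a)) odd
                           ; {ref a} (inj₂ even) → cong _⁻¹ (to (m%2≡0⇔parity≡0ℙ (toℕ a)) even) })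
                      , (λ { {rot a} p≡1ℙ → inj₁ (from (m%2≡1⇔parity≡1ℙ (toℕ a)) p≡1ℙ)
                           ; {ref a} p⁻¹≡1ℙ →
                               inj₂ (from (m%2≡0⇔parity≡0ℙ (toℕ a)) (sym (ℙ.⁻¹-selfInverse p⁻¹≡1ℙ))) })

  setA∪setC≐OffKernel : (setA ∪ setC) ≐ OffKernel {N} exponentParity
  setA∪setC≐OffKernel = (λ { {rot a} (inj₁ odd) → to (m%2≡1⇔parity≡1ℙ (toℕ a)) odd
                           ; {ref a} (inj₂ odd) → to (m%2≡1⇔parity≡1ℙ (toℕ a)) odd })
                      , (λ { {rot a} p≡1ℙ → inj₁ (from (m%2≡1⇔parity≡1ℙ (toℕ a)) p≡1ℙ)
                           ; {ref a} p≡1ℙ → inj₂ (from (m%2≡1⇔parity≡1ℙ (toℕ a)) p≡1ℙ) })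

  setB∪setC≐OffKernel : (setB ∪ setC) ≐ OffKernel {N} orientation
  setB∪setC≐OffKernel = (λ { {ref a} _ → refl ; {rot a} (inj₁ ()) ; {rot a} (inj₂ ()) })
                      , (λ { {ref a} _ → even-or-odd a ; {rot a} () })

-- The classification

module _ {k : ℕ} (c : Colouring (suc k)) where

  rotColour refColour : ℕ → Bool
  rotColour m = c (rot (m mod suc k))
  refColour m = c (ref (m mod suc k))

  refColour-periodic : Periodic refColour (suc k)
  refColour-periodic m = cong (c ∘ ref) ([m+N]mod≡m-mod m)

  ref-avoided : ∀ {d} → Avoided c (ref d) → ∀ m → refColour (m + toℕ d) ≢ rotColour m
  ref-avoided {d} avoided m same =
    avoided (rot (m mod suc k) , ref ((m + toℕ d) mod suc k) , (λ ()) , sym same ,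
             cong ref (trans ([m+n]mod⊖m-mod≡n-mod m (toℕ d)) (toℕ-mod-inverse d)))

  rot-avoided : ∀ {a} → Avoided c (rot a) → a ≢ zero → Antiperiodic refColour (toℕ a)
  rot-avoided {a} avoided a≢0 u same =
    avoided (ref (u mod suc k) , ref ((u + toℕ a) mod suc k) , distinct , sym same , cong rot shift)
    where
    shift : ((u + toℕ a) mod suc k) ⊖ (u mod suc k) ≡ a
    shift = trans ([m+n]mod⊖m-mod≡n-mod u (toℕ a)) (toℕ-mod-inverse a)
    distinct : ref (u mod suc k) ≢ ref ((u + toℕ a) mod suc k)
    distinct eq = a≢0 (begin
      a                                  ≡⟨ shift ⟨
      ((u + toℕ a) mod suc k) ⊖ (u mod suc k)  ≡⟨ cong (_⊖ (u mod suc k)) (ref-injective eq) ⟨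
      (u mod suc k) ⊖ (u mod suc k)            ≡⟨ ⊖-self (u mod suc k) ⟩
      zero                                     ∎)

  reflection-parities-agree : parity (suc k) ≡ 0ℙ → ∀ {a d d'} → Avoided c (rot a) → a ≢ zero →
    Avoided c (ref d) → Avoided c (ref d') → parity (toℕ d) ≡ parity (toℕ d')
  reflection-parities-agree N-even {a} {d} {d'} rot-av a≢0 d-av d'-av = +≡0ℙ⇒≡ (begin
    parity D ℙ.+ parity D'                           ≡⟨ cong (λ p → parity D ℙ.+ (p ℙ.+ parity D')) N-even ⟨
    parity D ℙ.+ (parity N ℙ.+ parity D')            ≡⟨ cong (parity D ℙ.+_) (parity-∸ D'≤N) ⟨
    parity D ℙ.+ parity (N ∸ D')                     ≡⟨ ℙ.+-homo-+ D (N ∸ D') ⟨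
    parity e                                         ≡⟨ antiperiodic∧periodic⇒parity≡0ℙ (rot-avoided rot-av a≢0) e-periodic ⟩
    0ℙ                                               ∎)
    where
    N = suc k
    D = toℕ d
    D' = toℕ d'
    D'≤N = <⇒≤ (Fin.toℕ<n d')
    e = D + (N ∸ D')  -- d − d' modulo N
    e-periodic : Periodic refColour e
    e-periodic m = begin
      refColour (m + (D + (N ∸ D')))  ≡⟨ cong refColour (trans (cong (m +_) (+-comm D (N ∸ D'))) (sym (+-assoc m _ D))) ⟩
      refColour (m' + D)              ≡⟨ ≢∧≢⇒≡ (ref-avoided d-av m') (ref-avoided d'-av m') ⟩
      refColour (m' + D')             ≡⟨ cong refColour (trans (+-assoc m _ D') (cong (m +_) (m∸n+n≡m D'≤N))) ⟩
      refColour (m + N)               ≡⟨ refColour-periodic m ⟩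
      refColour m                     ∎
      where m' = m + (N ∸ D')

module EvenDihedral {k : ℕ} (k≢0 : k ≢ 0) (N-even : parity (suc (suc k)) ≡ 0ℙ) where

  setA∪setB-saturated : Saturated {suc (suc k)} (setA ∪ setB)
  setA∪setB-saturated = Saturated-respects-≐ setA∪setB≐OffKernel
    (OffKernel-saturated
      (IsCharacter-+ {χ = orientation} {exponentParity} orientation-isCharacter (exponentParity-isCharacter N-even))
      {ref zero} refl (distinctFactors k≢0))

  setA∪setC-saturated : Saturated {suc (suc k)} (setA ∪ setC)
  setA∪setC-saturated = Saturated-respects-≐ setA∪setC≐OffKernel
    (OffKernel-saturated (exponentParity-isCharacter N-even) {rot (suc zero)} refl (distinctFactors k≢0))

  setB∪setC-saturated : Saturated {suc (suc k)} (setB ∪ setC)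
  setB∪setC-saturated = Saturated-respects-≐ setB∪setC≐OffKernel
    (OffKernel-saturated orientation-isCharacter {ref zero} refl (distinctFactors k≢0))

  saturated⇒classified : ∀ {U : Subset (suc (suc k))} → Saturated U → OnlyOddRotations U →
    U ≐ (setA ∪ setB) ⊎ U ≐ (setA ∪ setC) ⊎ U ≐ (setB ∪ setC)
  saturated⇒classified {U} U-saturated onlyOdd with saturated⇒≐Avoided U-saturated
  ... | c , U⊆Avoided , Avoided⊆U = classify (Fin.any? (U? ∘ rot)) (Fin.any? (U? ∘ ref))
    where
    U? : Decidable U
    U? z = map′ Avoided⊆U U⊆Avoided (Avoided? c z)

    fill : ∀ {V} → Saturated V → U ⊆ V → U ≐ V
    fill V-saturated U⊆V = saturated-⊆⇒≐ U-saturated U⊆V (proj₁ V-saturated)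

    odd⇒≢zero : ∀ {a} → Odd a → a ≢ zero
    odd⇒≢zero () refl

    parities-agree : ∀ {a d d'} → U (rot a) → U (ref d) → U (ref d') → parity (toℕ d) ≡ parity (toℕ d')
    parities-agree {a} Ua Ud Ud' = reflection-parities-agree c N-even
      (U⊆Avoided Ua) (odd⇒≢zero (onlyOdd a Ua)) (U⊆Avoided Ud) (U⊆Avoided Ud')

    classify : Dec (∃ (U ∘ rot)) → Dec (∃ (U ∘ ref)) →
      U ≐ (setA ∪ setB) ⊎ U ≐ (setA ∪ setC) ⊎ U ≐ (setB ∪ setC)
    classify (no ∄rot) _ = inj₂ (inj₂ (fill setB∪setC-saturated
      λ { {rot a} Ua → ⊥-elim (∄rot (a , Ua)) ; {ref d} _ → even-or-odd d }))
    classify (yes _) (no ∄ref) = inj₁ (fill setA∪setB-saturated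
      λ { {rot a} Ua → inj₁ (onlyOdd a Ua) ; {ref d} Ud → ⊥-elim (∄ref (d , Ud)) })
    classify (yes (a , Ua)) (yes (d , Ud)) with even-or-odd d
    ... | inj₁ d-even = inj₁ (fill setA∪setB-saturated
      λ { {rot a'} Ua' → inj₁ (onlyOdd a' Ua')
        ; {ref d'} Ud' → inj₂ (Even-resp-parity {a = d} {d'} (parities-agree Ua Ud Ud') d-even) })
    ... | inj₂ d-odd = inj₂ (inj₁ (fill setA∪setC-saturated
      λ { {rot a'} Ua' → inj₁ (onlyOdd a' Ua')
        ; {ref d'} Ud' → inj₂ (Odd-resp-parity {a = d} {d'} (parities-agree Ua Ud Ud') d-odd) }))

proposition4p4 : (n : ℕ) → 2 ≤ n → (U : Subset (2 * n)) → OnlyOddRotations U →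
    (Saturated U ⇔ (U ≐ (setA ∪ setB) ⊎ U ≐ (setA ∪ setC) ⊎ U ≐ (setB ∪ setC)))
proposition4p4 (suc (suc m)) _ U onlyOdd = mk⇔
  (λ U-saturated → saturated⇒classified U-saturated onlyOdd)
  [ (λ U≐ → Saturated-respects-≐ U≐ setA∪setB-saturated)
  , [ (λ U≐ → Saturated-respects-≐ U≐ setA∪setC-saturated)
    , (λ U≐ → Saturated-respects-≐ U≐ setB∪setC-saturated) ] ]
  -- 2 * (2 + m) normalises to 2 + (m + suc (suc (m + 0))), and parity 2 ℙ.* p to 0ℙ.
  where open EvenDihedral (m+1+n≢0 m) (ℙ.*-homo-* 2 (suc (suc m)))
proposition4p4 1 (s≤s ())
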